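{- Let $T$ be a tree and $v$ a leaf of $T$ with neighbor $w$. Let $n_l$ (resp. $n_i$) be the number of neighbors of $w$ that are leaves (resp. inner nodes). If $n_l>n_i$, then $E_{fix}(T)=E_{fix}(T\setminus v)$.
   Context: For a tree $T=(V,E)$, $E_{fix}(T)$ is the set of all $F\subseteq E$ with $2deg_F(u)\le deg(u)$ for every $u\in V$, where $deg_F(u)$ is the number of edges of $F$ incident to $u$ and $deg(u)$ is the degree of $u$ in $T$. $T\setminus v$ denotes the tree obtained by deleting $v$ and its incident edge; its edge set is a subset of that of $T$. -}

module Defs where

open import Data.Nat using (ℕ; zero; suc; _+_; _*_; _≤_; _≥_; _≡ᵇ_)
open import Data.Bool using (Bool; true; false; if_then_else_; not)
open import Data.Fin using (Fin; zero; suc; punchIn; punchOut; _≟_)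
open import Data.List using (List; []; _∷_; last)
open import Data.List.Relation.Unary.Linked using (Linked)
open import Data.List.Relation.Unary.Unique.Propositional using (Unique)
open import Data.Empty using (⊥)
open import Data.Product using (Σ; _×_; ∃)
open import Relation.Binary.PropositionalEquality using (_≡_; _≢_)
open import Relation.Nullary using (¬_; yes; no)

-- A (simple, undirected) graph on vertex set Fin n, given by a Boolean
-- adjacency relation; an edge subset F ⊆ E is represented the same way.
Rel₂ : ℕ → Set
Rel₂ n = Fin n → Fin n → Bool

count : ∀ {n} → (Fin n → Bool) → ℕ
count {zero}  p = 0
count {suc n} p = (if p zero then 1 else 0) + count (λ x → p (suc x))

deg : ∀ {n} → Rel₂ n → Fin n → ℕ
deg G u = count (G u)

Adj : ∀ {n} → Rel₂ n → Fin n → Fin n → Set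
Adj G u w = G u w ≡ true

IsSimpleGraph : ∀ {n} → Rel₂ n → Set
IsSimpleGraph G = (∀ i j → G i j ≡ G j i) × (∀ i → G i i ≡ false)

data Walk {n} (G : Rel₂ n) : Fin n → Fin n → Set where
  here : ∀ {u} → Walk G u u
  step : ∀ {u x w} → Adj G u x → Walk G x w → Walk G u w

Connected : ∀ {n} → Rel₂ n → Set
Connected G = ∀ u w → Walk G u w

IsCycle : ∀ {n} → Rel₂ n → List (Fin n) → Set
IsCycle G [] = ⊥
IsCycle G (x ∷ []) = ⊥
IsCycle G (x ∷ y ∷ []) = ⊥
IsCycle G (x ∷ y ∷ z ∷ zs) =
  Unique (x ∷ y ∷ z ∷ zs) × Linked (Adj G) (x ∷ y ∷ z ∷ zs) × Adj G (lastOf z zs) x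
  where
    lastOf : _ → List _ → _
    lastOf a [] = a
    lastOf a (b ∷ bs) = lastOf b bs

Acyclic : ∀ {n} → Rel₂ n → Set
Acyclic G = ∀ xs → ¬ IsCycle G xs

IsTree : ∀ {n} → Rel₂ n → Set
IsTree G = IsSimpleGraph G × Connected G × Acyclic G

IsEdgeSubset : ∀ {n} → Rel₂ n → Rel₂ n → Set
IsEdgeSubset G F = (∀ i j → F i j ≡ F j i) × (∀ i j → F i j ≡ true → G i j ≡ true)

InEfix : ∀ {n} → Rel₂ n → Rel₂ n → Set
InEfix G F = IsEdgeSubset G F × (∀ u → 2 * deg F u ≤ deg G u)

isLeaf : ∀ {n} → Rel₂ n → Fin n → Bool
isLeaf G u = deg G u ≡ᵇ 1

nLeafNbrs : ∀ {n} → Rel₂ n → Fin n → ℕ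
nLeafNbrs G w = count (λ u → if G w u then isLeaf G u else false)

nInnerNbrs : ∀ {n} → Rel₂ n → Fin n → ℕ
nInnerNbrs G w = count (λ u → if G w u then not (isLeaf G u) else false)

delete : ∀ {m} → Rel₂ (suc m) → Fin (suc m) → Rel₂ m
delete G v i j = G (punchIn v i) (punchIn v j)

restrict : ∀ {m} → Fin (suc m) → Rel₂ (suc m) → Rel₂ m
restrict v F i j = F (punchIn v i) (punchIn v j)

extend : ∀ {m} → Fin (suc m) → Rel₂ m → Rel₂ (suc m)
extend v F i j with v ≟ i | v ≟ j
... | yes _ | _ = false
... | no _  | yes _ = false
... | no v≢i | no v≢j = F (punchOut v≢i) (punchOut v≢j)

{-# OPTIONS --safe #-}
module Submission where

-- A leaf carries no edge of any F ∈ E_fix(T), since 2·deg_F ≤ 1 there. Hence every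
-- F-edge at w goes to an inner neighbour, so 2·deg_F(w) ≤ 2·n_i < n_l + n_i = deg(w):
-- the slack at w absorbs the loss of the edge vw when v is deleted, and no other
-- vertex loses an edge. Conversely, deleting v only lowers degrees, so an edge set of
-- T ∖ v that is in E_fix(T ∖ v) stays in E_fix(T).

open import Defs
open import Data.Nat using (ℕ; zero; suc; _>_; _+_; _*_; _≤_; _<_; z≤n; s≤s; s≤s⁻¹)
open import Data.Nat.Properties
  using (+-mono-≤; +-monoˡ-<; *-monoʳ-≤; ≤-refl; ≤-trans; m≤n+m; +-identityʳ; +-suc;
         suc-injective; ≡ᵇ⇒≡; +-commutativeSemigroup; module ≤-Reasoning)
open import Algebra.Properties.CommutativeSemigroup +-commutativeSemigroup using (x∙yz≈y∙xz)
open import Data.Bool using (Bool; true; false; if_then_else_; not)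
import Data.Bool
open import Data.Unit using (tt)
open import Data.Fin using (Fin; zero; suc; punchIn; punchOut; _≟_)
open import Data.Fin.Properties using (punchOut-cong; punchIn-punchOut; punchInᵢ≢i; punchOut-punchIn)
open import Data.Product using (_×_; _,_)
open import Function using (_∘_)
open import Relation.Nullary using (yes; no; contradiction)
open import Relation.Binary.PropositionalEquality

⟦_⟧ : Bool → ℕ
⟦ b ⟧ = if b then 1 else 0

count-cong : ∀ {n} {p q : Fin n → Bool} → (∀ x → p x ≡ q x) → count p ≡ count q
count-cong {zero}  p≡q = refl
count-cong {suc n} p≡q = cong₂ _+_ (cong ⟦_⟧ (p≡q zero)) (count-cong (p≡q ∘ suc))

count-mono : ∀ {n} {p q : Fin n → Bool} → (∀ x → p x ≡ true → q x ≡ true) → count p ≤ count q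
count-mono {zero}               p⇒q = z≤n
count-mono {suc n} {p} {q} p⇒q = +-mono-≤ (⟦⟧-mono (p zero) (p⇒q zero)) (count-mono (p⇒q ∘ suc))
  where
  ⟦⟧-mono : ∀ a {b} → (a ≡ true → b ≡ true) → ⟦ a ⟧ ≤ ⟦ b ⟧
  ⟦⟧-mono false a⇒b = z≤n
  ⟦⟧-mono true  a⇒b rewrite a⇒b refl = ≤-refl

count-false : ∀ {n} (p : Fin n → Bool) → (∀ x → p x ≡ false) → count p ≡ 0
count-false {zero}  p p≡false = refl
count-false {suc n} p p≡false rewrite p≡false zero = count-false (p ∘ suc) (p≡false ∘ suc)

count-punchIn : ∀ {m} (v : Fin (suc m)) (p : Fin (suc m) → Bool) →
                count p ≡ ⟦ p v ⟧ + count (p ∘ punchIn v)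
count-punchIn zero            p = refl
count-punchIn {suc m} (suc v) p = begin
  ⟦ p zero ⟧ + count (p ∘ suc)                                    ≡⟨ cong (⟦ p zero ⟧ +_) (count-punchIn v (p ∘ suc)) ⟩
  ⟦ p zero ⟧ + (⟦ p (suc v) ⟧ + count (p ∘ suc ∘ punchIn v))       ≡⟨ x∙yz≈y∙xz ⟦ p zero ⟧ ⟦ p (suc v) ⟧ _ ⟩
  ⟦ p (suc v) ⟧ + (⟦ p zero ⟧ + count (p ∘ suc ∘ punchIn v))       ∎
  where open ≡-Reasoning

count-pos : ∀ {m} (p : Fin (suc m) → Bool) x → p x ≡ true → 1 ≤ count p
count-pos p x px rewrite count-punchIn x p | px = s≤s z≤n

count≡0⇒false : ∀ {m} (p : Fin m → Bool) → count p ≡ 0 → ∀ x → p x ≡ false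
count≡0⇒false {suc m} p count≡0 x with p x in px
... | false = refl
... | true  = contradiction (subst (1 ≤_) count≡0 (count-pos p x px)) λ ()

count-split : ∀ {n} (p q : Fin n → Bool) →
  count p ≡ count (λ u → if p u then q u else false) + count (λ u → if p u then not (q u) else false)
count-split {zero}  p q = refl
count-split {suc n} p q with p zero | q zero
... | false | _     = count-split (p ∘ suc) (q ∘ suc)
... | true  | true  = cong suc (count-split (p ∘ suc) (q ∘ suc))
... | true  | false = trans (cong suc (count-split (p ∘ suc) (q ∘ suc))) (sym (+-suc _ _))

≤-drop-⟦⟧ : ∀ b {a d} → a ≤ ⟦ b ⟧ + d → (b ≡ true → a < ⟦ b ⟧ + d) → a ≤ d
≤-drop-⟦⟧ false a≤d _     = a≤d
≤-drop-⟦⟧ true  _   a<1+d = s≤s⁻¹ (a<1+d refl)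

data PunchInView {m} (v : Fin (suc m)) : Fin (suc m) → Set where
  at-v    : PunchInView v v
  punched : ∀ i → PunchInView v (punchIn v i)

punchInView : ∀ {m} (v i : Fin (suc m)) → PunchInView v i
punchInView v i with v ≟ i
... | yes refl = at-v
... | no v≢i   = subst (PunchInView v) (punchIn-punchOut v≢i) (punched (punchOut v≢i))

deg-punchIn : ∀ {m} (G : Rel₂ (suc m)) v u →
              deg G (punchIn v u) ≡ ⟦ G (punchIn v u) v ⟧ + deg (delete G v) u
deg-punchIn G v u = count-punchIn v (G (punchIn v u))

leaf-neighbour-unique : ∀ {m} (G : Rel₂ (suc m)) {v w x} →
                        deg G v ≡ 1 → Adj G v w → Adj G v x → x ≡ w
leaf-neighbour-unique G {v} {w} {x} leaf vw vx with w ≟ x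
... | yes w≡x = sym w≡x
... | no  w≢x = contradiction (trans (sym vx) v≁x) λ ()
  where
  others≡0 : count (G v ∘ punchIn w) ≡ 0
  others≡0 = suc-injective (begin
    1 + count (G v ∘ punchIn w)           ≡⟨ cong (λ b → ⟦ b ⟧ + count (G v ∘ punchIn w)) (sym vw) ⟩
    ⟦ G v w ⟧ + count (G v ∘ punchIn w)   ≡⟨ sym (count-punchIn w (G v)) ⟩
    deg G v                               ≡⟨ leaf ⟩
    1                                     ∎)
    where open ≡-Reasoning
  v≁x : G v x ≡ false
  v≁x = subst (λ y → G v y ≡ false) (punchIn-punchOut w≢x)
          (count≡0⇒false (G v ∘ punchIn w) others≡0 (punchOut w≢x))

Efix-leaf-no-edge : ∀ {m} {G F : Rel₂ (suc m)} → InEfix G F → ∀ {x} → deg G x ≡ 1 → ∀ y → F x y ≡ false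
Efix-leaf-no-edge {F = F} (_ , Fdeg) {x} leaf y with F x y in e
... | false = refl
... | true  = contradiction (≤-trans (*-monoʳ-≤ 2 (count-pos (F x) y e)) (subst (2 * deg F x ≤_) leaf (Fdeg x)))
                λ { (s≤s ()) }

Efix-deg≤innerNbrs : ∀ {m} {G F : Rel₂ (suc m)} → InEfix G F → ∀ w → deg F w ≤ nInnerNbrs G w
Efix-deg≤innerNbrs {G = G} {F} inF@((Fsym , F⊆G) , _) w = count-mono inner
  where
  inner : ∀ x → F w x ≡ true → (if G w x then not (isLeaf G x) else false) ≡ true
  inner x wx rewrite F⊆G w x wx with isLeaf G x in leaf
  ... | false = refl
  ... | true  = contradiction (trans (sym wx) (trans (Fsym w x) (Efix-leaf-no-edge inF x-leaf w))) λ ()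
    where
    x-leaf : deg G x ≡ 1
    x-leaf = ≡ᵇ⇒≡ _ 1 (subst Data.Bool.T (sym leaf) tt)

Efix-slack : ∀ {m} {G F : Rel₂ (suc m)} → InEfix G F →
             ∀ w → nLeafNbrs G w > nInnerNbrs G w → 2 * deg F w < deg G w
Efix-slack {G = G} {F} inF w nl>ni = begin-strict
  2 * deg F w          ≤⟨ *-monoʳ-≤ 2 (Efix-deg≤innerNbrs inF w) ⟩
  2 * ni               ≡⟨ cong (ni +_) (+-identityʳ ni) ⟩
  ni + ni              <⟨ +-monoˡ-< ni nl>ni ⟩
  nLeafNbrs G w + ni   ≡⟨ sym (count-split (G w) (isLeaf G)) ⟩
  deg G w              ∎
  where
  open ≤-Reasoning
  ni : ℕ
  ni = nInnerNbrs G w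

restrict-Efix : ∀ {m} {G F : Rel₂ (suc m)} {v} → InEfix G F → (∀ u → F v u ≡ false) →
                (∀ u → Adj G u v → 2 * deg F u < deg G u) → InEfix (delete G v) (restrict v F)
restrict-Efix {m} {G} {F} {v} ((Fsym , F⊆G) , Fdeg) v-isolated slack =
  ((λ i j → Fsym _ _) , (λ i j → F⊆G _ _)) , deg-bound
  where
  deg-bound : ∀ u → 2 * deg (restrict v F) u ≤ deg (delete G v) u
  deg-bound u = ≤-drop-⟦⟧ (G x v) (shift {_≤_} (Fdeg x)) (shift {_<_} ∘ slack x)
    where
    x : Fin (suc m)
    x = punchIn v u
    deg-restrict : deg F x ≡ deg (restrict v F) u
    deg-restrict = trans (deg-punchIn F v u)
                         (cong (λ b → ⟦ b ⟧ + deg (restrict v F) u) (trans (Fsym x v) (v-isolated x)))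
    shift : ∀ {R : ℕ → ℕ → Set} → R (2 * deg F x) (deg G x) →
            R (2 * deg (restrict v F) u) (⟦ G x v ⟧ + deg (delete G v) u)
    shift {R} = subst₂ R (cong (2 *_) deg-restrict) (deg-punchIn G v u)

module _ {m} {v : Fin (suc m)} {F : Rel₂ m} where

  extend-at-v : ∀ {j} → extend v F v j ≡ false
  extend-at-v with v ≟ v
  ... | yes _   = refl
  ... | no v≢v = contradiction refl v≢v

  extend-to-v : ∀ {i} → extend v F i v ≡ false
  extend-to-v {i} with v ≟ i | v ≟ v
  ... | yes _ | _      = refl
  ... | no _  | yes _  = refl
  ... | no _  | no v≢v = contradiction refl v≢v

  extend-punchIn : ∀ {i j} → extend v F (punchIn v i) (punchIn v j) ≡ F i j
  extend-punchIn {i} {j} with v ≟ punchIn v i | v ≟ punchIn v j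
  ... | yes v≡i | _       = contradiction (sym v≡i) (punchInᵢ≢i v i)
  ... | no _    | yes v≡j = contradiction (sym v≡j) (punchInᵢ≢i v j)
  ... | no _    | no _    = cong₂ F (trans (punchOut-cong v refl) (punchOut-punchIn v))
                                    (trans (punchOut-cong v refl) (punchOut-punchIn v))

  extend-sym : (∀ i j → F i j ≡ F j i) → ∀ i j → extend v F i j ≡ extend v F j i
  extend-sym Fsym i j with punchInView v i | punchInView v j
  ... | at-v      | _         = trans extend-at-v (sym extend-to-v)
  ... | punched i | at-v      = trans extend-to-v (sym extend-at-v)
  ... | punched i | punched j = trans extend-punchIn (trans (Fsym i j) (sym extend-punchIn))

  extend-⊆ : ∀ {G : Rel₂ (suc m)} → (∀ i j → F i j ≡ true → delete G v i j ≡ true) →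
             ∀ i j → extend v F i j ≡ true → G i j ≡ true
  extend-⊆ F⊆G i j with punchInView v i | punchInView v j
  ... | at-v      | _         = λ e → contradiction (trans (sym e) extend-at-v) λ ()
  ... | punched i | at-v      = λ e → contradiction (trans (sym e) extend-to-v) λ ()
  ... | punched i | punched j = F⊆G i j ∘ trans (sym extend-punchIn)

  deg-extend-v : deg (extend v F) v ≡ 0
  deg-extend-v = count-false (extend v F v) (λ _ → extend-at-v)

  deg-extend-punchIn : ∀ u → deg (extend v F) (punchIn v u) ≡ deg F u
  deg-extend-punchIn u = begin
    deg (extend v F) (punchIn v u)
      ≡⟨ deg-punchIn (extend v F) v u ⟩
    ⟦ extend v F (punchIn v u) v ⟧ + deg (delete (extend v F) v) u
      ≡⟨ cong₂ _+_ (cong ⟦_⟧ extend-to-v) (count-cong (λ j → extend-punchIn {u} {j})) ⟩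
    deg F u
      ∎
    where open ≡-Reasoning

extend-Efix : ∀ {m} {G : Rel₂ (suc m)} {v} {F : Rel₂ m} → InEfix (delete G v) F → InEfix G (extend v F)
extend-Efix {G = G} {v} {F} ((Fsym , F⊆G) , Fdeg) = (extend-sym {v = v} Fsym , extend-⊆ {v = v} F⊆G) , deg-bound
  where
  deg-bound : ∀ u → 2 * deg (extend v F) u ≤ deg G u
  deg-bound u with punchInView v u
  ... | at-v rewrite deg-extend-v {v = v} {F} = z≤n
  ... | punched u = begin
    2 * deg (extend v F) (punchIn v u)           ≡⟨ cong (2 *_) (deg-extend-punchIn {v = v} {F} u) ⟩
    2 * deg F u                                  ≤⟨ Fdeg u ⟩
    deg (delete G v) u                           ≤⟨ m≤n+m _ _ ⟩
    ⟦ G (punchIn v u) v ⟧ + deg (delete G v) u   ≡⟨ sym (deg-punchIn G v u) ⟩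
    deg G (punchIn v u)                          ∎
    where open ≤-Reasoning

lemma7 : ∀ {m} (T : Rel₂ (suc m)) → IsTree T →
         (v w : Fin (suc m)) → deg T v ≡ 1 → Adj T v w →
         nLeafNbrs T w > nInnerNbrs T w →
         -- E_fix(T) ⊆ E_fix(T ∖ v) : every F ∈ E_fix(T) avoids v and is in E_fix(T ∖ v)
         ((F : Rel₂ (suc m)) → InEfix T F →
            (∀ u → F v u ≡ false) × InEfix (delete T v) (restrict v F))
         ×
         -- E_fix(T ∖ v) ⊆ E_fix(T)
         ((F : Rel₂ m) → InEfix (delete T v) F → InEfix T (extend v F))
lemma7 T ((Tsym , _) , _) v w leaf vw nl>ni = restrict-to-Efix , λ F → extend-Efix
  where
  restrict-to-Efix : ∀ F → InEfix T F → (∀ u → F v u ≡ false) × InEfix (delete T v) (restrict v F)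
  restrict-to-Efix F inF = v-isolated , restrict-Efix inF v-isolated slack
    where
    v-isolated : ∀ u → F v u ≡ false
    v-isolated = Efix-leaf-no-edge inF leaf
    slack : ∀ u → Adj T u v → 2 * deg F u < deg T u
    slack u uv rewrite leaf-neighbour-unique T leaf vw (trans (Tsym v u) uv) = Efix-slack inF w nl>ni
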